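{- (i) Saturated bisimilarity implies $\mathrm{true}$-conditional bisimilarity: ${\sim_C}\subseteq{\simeq_T}$. (ii) The converse fails in general: there exist a category $\mathbf C$ with distinguished object $0$, a representative class of squares $\kappa$, a conditional reactive system $\mathcal S$ and arrows $a,b\colon 0\to J$ with $(a,b)\in{\simeq_T}$ but $(a,b)\notin{\sim_C}$.
   Context: Composition of $f\colon A\to B$, $g\colon B\to C$ is written $f;g$. Fix a category $\mathbf C$ with distinguished object $0$ and a representative class $\kappa$ of commuting squares: for every commuting square $\alpha_1;\delta_1=\alpha_2;\delta_2$ there are $(\alpha_1,\alpha_2,\beta_1,\beta_2)\in\kappa$ (a commuting square) and $\gamma$ with $\delta_1=\beta_1;\gamma$, $\delta_2=\beta_2;\gamma$; $\kappa(\alpha_1,\alpha_2)$ is the set of $(\beta_1,\beta_2)$ with $(\alpha_1,\alpha_2,\beta_1,\beta_2)\in\kappa$. Conditions over $A$ are defined inductively as $(A,\mathcal Q,S)$, $\mathcal Q\in\{\forall,\exists\}$, $S$ a finite set of pairs $(h,\mathcal A')$ with $h\colon A\to A'$, $\mathcal A'$ a condition over $A'$; $\mathrm{true}_A=(A,\forall,\emptyset)$. For $a\colon A\to B$: $a\models(A,\forall,S)$ iff for all $(h,\mathcal A')\in S$ and all $g$ with $a=h;g$, $g\models\mathcal A'$; $a\models(A,\exists,S)$ iff some $(h,\mathcal A')\in S$ and $g$ satisfy $a=h;g$, $g\models\mathcal A'$. $\mathcal A\models\mathcal B$: every arrow satisfying $\mathcal A$ satisfies $\mathcal B$. Boolean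 connectives have the standard semantics. Shift along $c\colon A\to B$: $(A,\mathcal Q,S)_{\downarrow c}=(B,\mathcal Q,\{(\beta,\mathcal A'_{\downarrow\alpha})\mid(h,\mathcal A')\in S,(\alpha,\beta)\in\kappa(h,c)\})$; it satisfies $c;d\models\mathcal A\iff d\models\mathcal A_{\downarrow c}$. A conditional reactive system is a set $\mathcal S$ of rules $(\ell,r,\mathcal R)$, $\ell,r\colon0\to I$, $\mathcal R$ a condition over $I$. Context step $a\xrightarrow[C]{f,\ \mathcal A}a'$ ($a\colon0\to J$, $f\colon J\to K$, $a'\colon0\to K$, $\mathcal A$ over $K$): there are a rule $(\ell,r,\mathcal R)\in\mathcal S$ and $c\colon I\to K$ with $a;f=\ell;c$, $a'=r;c$, $\mathcal A\models\mathcal R_{\downarrow c}$. $\mathcal D\models\bigvee_{i\in I}\mathcal E_i$ (possibly infinite $I$): every arrow satisfying $\mathcal D$ satisfies some $\mathcal E_i$. A saturated bisimulation is a binary relation $R$ on pairs of arrows $a,b\colon0\to J$ such that for all $(a,b)\in R$ and every context step $a\xrightarrow[C]{f,\ \mathcal A}a'$ there are finitely many context steps $b\xrightarrow[C]{f,\ \mathcal B_i}b'_i$, $i\in I$, with $(a',b'_i)\in R$ and $\mathcal A\models\bigvee_{i\in I}\mathcal B_i$, and symmetrically for context steps of $b$; saturated bisimilarity $\sim_C$ is the union of all saturated bisimulations. A conditional relation is a set of triples $(a,b,\mathcal C)$, $a,b\colon0\to J$, $\mathcal C$ a condition over $J$. A conditional bisimulation is a conditional relation $R$ such that for each $(a,b,\mathcal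 C)\in R$ and each context step $a\xrightarrow[C]{f,\ \mathcal A}a'$ there are a (possibly infinite) index set $I$, context steps $b\xrightarrow[C]{f,\ \mathcal B_i}b'_i$ and conditions $\mathcal C'_i$ with $(a',b'_i,\mathcal C'_i)\in R$ and $\mathcal A\land\mathcal C_{\downarrow f}\models\bigvee_{i\in I}(\mathcal C'_i\land\mathcal B_i)$, and symmetrically for context steps of $b$; $\simeq_C$ is the set of triples in some conditional bisimulation, and ${\simeq_T}=\{(a,b)\mid a,b\colon0\to J,\ (a,b,\mathrm{true}_J)\in{\simeq_C}\}$. -}

module Defs where

open import Data.List using (List; []; _∷_; _++_)
open import Data.List.Membership.Propositional using (_∈_)
open import Data.Product using (Σ; Σ-syntax; _×_; _,_)
open import Data.Sum using (_⊎_)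
open import Data.Unit using (⊤)
open import Data.Empty using (⊥)
open import Data.Nat using (ℕ)
open import Data.Fin using (Fin)
open import Relation.Binary.PropositionalEquality using (_≡_)

-- A (locally small, level-0) category; composition f ⨾ g is "f;g" (diagrammatic order).
record Category : Set₁ where
  infixr 9 _⨾_
  field
    Obj       : Set
    Hom       : Obj → Obj → Set
    id        : ∀ {A} → Hom A A
    _⨾_       : ∀ {A B C} → Hom A B → Hom B C → Hom A C
    identityˡ : ∀ {A B} (f : Hom A B) → id ⨾ f ≡ f
    identityʳ : ∀ {A B} (f : Hom A B) → f ⨾ id ≡ f
    assoc     : ∀ {A B C D} (f : Hom A B) (g : Hom B C) (h : Hom C D) →
                (f ⨾ g) ⨾ h ≡ f ⨾ (g ⨾ h)

-- A category with distinguished object 𝟎 and a representative class κ of squares.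
-- κ α₁ α₂ lists the pairs (β₁ , β₂) with (α₁ , α₂ , β₁ , β₂) ∈ κ  (finite, so that
-- shifts of conditions are again conditions with finite branch sets).
record Setting : Set₁ where
  field
    cat : Category
  open Category cat
  field
    𝟎  : Obj
    κ  : ∀ {A B₁ B₂} → Hom A B₁ → Hom A B₂ → List (Σ[ D ∈ Obj ] (Hom B₁ D × Hom B₂ D))
    κ-commutes : ∀ {A B₁ B₂} (α₁ : Hom A B₁) (α₂ : Hom A B₂) {D : Obj}
                   {β₁ : Hom B₁ D} {β₂ : Hom B₂ D} →
                   (D , β₁ , β₂) ∈ κ α₁ α₂ → α₁ ⨾ β₁ ≡ α₂ ⨾ β₂
    κ-representative : ∀ {A B₁ B₂ E} (α₁ : Hom A B₁) (α₂ : Hom A B₂)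
                   (δ₁ : Hom B₁ E) (δ₂ : Hom B₂ E) → α₁ ⨾ δ₁ ≡ α₂ ⨾ δ₂ →
                   Σ[ D ∈ Obj ] Σ[ β₁ ∈ Hom B₁ D ] Σ[ β₂ ∈ Hom B₂ D ]
                     ((D , β₁ , β₂) ∈ κ α₁ α₂ ×
                      Σ[ γ ∈ Hom D E ] (δ₁ ≡ β₁ ⨾ γ × δ₂ ≡ β₂ ⨾ γ))

data Quant : Set where
  ∀Q ∃Q : Quant

module Theory (X : Setting) where
  open Setting X public
  open Category cat public

  data Cond (A : Obj) : Set where
    cond : Quant → List (Σ[ A' ∈ Obj ] (Hom A A' × Cond A')) → Cond A

  Branches : Obj → Set
  Branches A = List (Σ[ A' ∈ Obj ] (Hom A A' × Cond A'))

  true : (A : Obj) → Cond A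
  true A = cond ∀Q []

  mutual
    _⊨_ : ∀ {A B} → Hom A B → Cond A → Set
    a ⊨ cond ∀Q S = ⊨All a S
    a ⊨ cond ∃Q S = ⊨Any a S

    ⊨All : ∀ {A B} → Hom A B → Branches A → Set
    ⊨All a [] = ⊤
    ⊨All {B = B} a ((A' , h , 𝒜') ∷ S) =
      (∀ (g : Hom A' B) → a ≡ h ⨾ g → g ⊨ 𝒜') × ⊨All a S

    ⊨Any : ∀ {A B} → Hom A B → Branches A → Set
    ⊨Any a [] = ⊥
    ⊨Any {B = B} a ((A' , h , 𝒜') ∷ S) =
      (Σ[ g ∈ Hom A' B ] (a ≡ h ⨾ g × g ⊨ 𝒜')) ⊎ ⊨Any a S

  _⊨ᶜ_ : ∀ {A} → Cond A → Cond A → Set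
  _⊨ᶜ_ {A} 𝒜 ℬ = ∀ {B} (a : Hom A B) → a ⊨ 𝒜 → a ⊨ ℬ

  mutual
    _↓_ : ∀ {A B} → Cond A → Hom A B → Cond B
    cond 𝒬 S ↓ c = cond 𝒬 (shiftBr S c)

    shiftBr : ∀ {A B} → Branches A → Hom A B → Branches B
    shiftBr [] c = []
    shiftBr ((A' , h , 𝒜') ∷ S) c = shiftκ 𝒜' (κ h c) ++ shiftBr S c

    shiftκ : ∀ {A' B} → Cond A' → List (Σ[ D ∈ Obj ] (Hom A' D × Hom B D)) → Branches B
    shiftκ 𝒜' [] = []
    shiftκ 𝒜' ((D , α , β) ∷ ks) = (D , β , (𝒜' ↓ α)) ∷ shiftκ 𝒜' ks

  record Rule : Set where
    field
      I : Obj
      ℓ : Hom 𝟎 I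
      r : Hom 𝟎 I
      R : Cond I

  -- a conditional reactive system: an arbitrary set of rules, given as a family
  record System : Set₁ where
    field
      Idx  : Set
      rule : Idx → Rule

  module _ (𝒮 : System) where
    open System 𝒮

    Step : ∀ {J K} → Hom 𝟎 J → Hom J K → Cond K → Hom 𝟎 K → Set
    Step {J} {K} a f 𝒜 a' =
      Σ[ i ∈ Idx ] (let open Rule (rule i) in
        Σ[ c ∈ Hom I K ] (a ⨾ f ≡ ℓ ⨾ c × a' ≡ r ⨾ c × 𝒜 ⊨ᶜ (R ↓ c)))

    BRel : Set₁
    BRel = ∀ {J} → Hom 𝟎 J → Hom 𝟎 J → Set

    SatSim : BRel → Set
    SatSim Rel = ∀ {J K} (a b : Hom 𝟎 J) → Rel a b →
      ∀ (f : Hom J K) (𝒜 : Cond K) (a' : Hom 𝟎 K) → Step a f 𝒜 a' →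
      Σ[ n ∈ ℕ ] Σ[ ℬ ∈ (Fin n → Cond K) ] Σ[ b' ∈ (Fin n → Hom 𝟎 K) ]
        ((∀ i → Step b f (ℬ i) (b' i)) × (∀ i → Rel a' (b' i)) ×
         (∀ {L} (d : Hom K L) → d ⊨ 𝒜 → Σ[ i ∈ Fin n ] d ⊨ ℬ i))

    IsSatBisim : BRel → Set
    IsSatBisim Rel = SatSim Rel × SatSim (λ x y → Rel y x)

    _∼C_ : ∀ {J} → Hom 𝟎 J → Hom 𝟎 J → Set₁
    a ∼C b = Σ[ Rel ∈ BRel ] (IsSatBisim Rel × Rel a b)

    CRel : Set₁
    CRel = ∀ {J} → Hom 𝟎 J → Hom 𝟎 J → Cond J → Set

    CondSim : CRel → Set₁
    CondSim Rel = ∀ {J K} (a b : Hom 𝟎 J) (𝒞 : Cond J) → Rel a b 𝒞 →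
      ∀ (f : Hom J K) (𝒜 : Cond K) (a' : Hom 𝟎 K) → Step a f 𝒜 a' →
      Σ[ Ix ∈ Set ] Σ[ ℬ ∈ (Ix → Cond K) ] Σ[ b' ∈ (Ix → Hom 𝟎 K) ] Σ[ 𝒞' ∈ (Ix → Cond K) ]
        ((∀ i → Step b f (ℬ i) (b' i)) × (∀ i → Rel a' (b' i) (𝒞' i)) ×
         (∀ {L} (d : Hom K L) → d ⊨ 𝒜 → d ⊨ (𝒞 ↓ f) →
            Σ[ i ∈ Ix ] (d ⊨ 𝒞' i × d ⊨ ℬ i)))

    IsCondBisim : CRel → Set₁
    IsCondBisim Rel = CondSim Rel × CondSim (λ x y 𝒞 → Rel y x 𝒞)

    ≃C : ∀ {J} → Hom 𝟎 J → Hom 𝟎 J → Cond J → Set₁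
    ≃C a b 𝒞 = Σ[ Rel ∈ CRel ] (IsCondBisim Rel × Rel a b 𝒞)

    _≃T_ : ∀ {J} → Hom 𝟎 J → Hom 𝟎 J → Set₁
    _≃T_ {J} a b = ≃C a b (true J)

module Submission where

-- (i) A saturated bisimulation R becomes a conditional bisimulation once every
-- pair is decorated with an arbitrary condition and every answering step with
-- the condition true: the finitely many answers of the saturated game are in
-- particular a family of answers, and they already cover 𝒜 without using the
-- context condition 𝒞↓f.
--
-- (ii) The converse fails because conditional bisimulations may answer with
-- infinitely many steps.  We build a two-object category {0, J} in which the
-- contexts J → J form the additive monoid ℕ.  The agent A reduces under any
-- context n unconditionally; the agent B has, for every j, a rule whose
-- condition says "the total context is exactly j".  A and B are
-- true-conditionally bisimilar (A's step under context n is answered by the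
-- ℕ-indexed family of B-steps, one for each possible total context), but not
-- saturated bisimilar: finitely many B-steps pin down only finitely many
-- contexts, and no finite set of naturals covers ℕ.

open import Defs
open import Data.Empty using (⊥; ⊥-elim)
open import Data.Fin using (Fin)
import Data.Fin as Fin
open import Data.List using (List; []; _∷_)
open import Data.List.Membership.Propositional using (_∈_)
open import Data.List.Relation.Unary.Any using (here; there)
open import Data.Nat using (ℕ; zero; suc; _+_; _∸_; _<_)
open import Data.Nat.Properties
open import Data.Product using (Σ; Σ-syntax; _×_; _,_; proj₁; proj₂)
open import Data.Sum using (_⊎_; inj₁; inj₂)
open import Data.Unit using (⊤; tt)
open import Function using (_∘_)
open import Relation.Binary.Definitions using (DecidableEquality)
open import Relation.Binary.PropositionalEquality
open import Relation.Nullary using (¬_; yes; no)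

module General (X : Setting) where
  open Theory X

  module _ (𝒮 : System) where

    satSim⇒condSim : {Rel : BRel 𝒮} → SatSim 𝒮 Rel → CondSim 𝒮 (λ x y _ → Rel x y)
    satSim⇒condSim sim a b 𝒞 aRb f 𝒜 a' step
      with sim a b aRb f 𝒜 a' step
    ... | n , ℬ , b' , steps , related , covers =
      Fin n , ℬ , b' , (λ _ → true _) , steps , related ,
      λ d d⊨𝒜 _ → proj₁ (covers d d⊨𝒜) , tt , proj₂ (covers d d⊨𝒜)

    ∼C⇒≃T : ∀ {J} (a b : Hom 𝟎 J) → _∼C_ 𝒮 a b → _≃T_ 𝒮 a b
    ∼C⇒≃T a b (Rel , (forth , back) , aRb) =
      (λ x y _ → Rel x y) , (satSim⇒condSim forth , satSim⇒condSim back) , aRb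

    symmetric-condBisim : {Rel : CRel 𝒮} →
      (∀ {J} {x y : Hom 𝟎 J} {𝒞} → Rel x y 𝒞 → Rel y x 𝒞) →
      CondSim 𝒮 Rel → IsCondBisim 𝒮 Rel
    symmetric-condBisim {Rel} sym-Rel sim = sim , back
      where
      back : CondSim 𝒮 (λ x y 𝒞 → Rel y x 𝒞)
      back a b 𝒞 bRa f 𝒜 a' step
        with sim a b 𝒞 (sym-Rel bRa) f 𝒜 a' step
      ... | Ix , ℬ , b' , 𝒞' , steps , related , covers =
        Ix , ℬ , b' , 𝒞' , steps , (λ i → sym-Rel (related i)) , covers

join-commutes : ∀ h c → h + (c ∸ h) ≡ c + (h ∸ c)
join-commutes zero    zero    = refl
join-commutes zero    (suc c) = cong suc (sym (+-identityʳ c))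
join-commutes (suc h) zero    = cong suc (+-identityʳ h)
join-commutes (suc h) (suc c) = cong suc (join-commutes h c)

join-factors : ∀ h c d₁ d₂ → h + d₁ ≡ c + d₂ →
  Σ[ γ ∈ ℕ ] (d₁ ≡ (c ∸ h) + γ × d₂ ≡ (h ∸ c) + γ)
join-factors zero    zero    d₁ d₂ e = d₁ , refl , sym e
join-factors zero    (suc c) d₁ d₂ e = d₂ , e , refl
join-factors (suc h) zero    d₁ d₂ e = d₁ , refl , sym e
join-factors (suc h) (suc c) d₁ d₂ e = join-factors h c d₁ d₂ (suc-injective e)

finite-bounded : ∀ n (js : Fin n → ℕ) → Σ[ B ∈ ℕ ] (∀ i → js i < B)
finite-bounded zero    js = 0 , λ ()
finite-bounded (suc n) js with finite-bounded n (js ∘ Fin.suc)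
... | B , below = suc (js Fin.zero) + B , bound
  where
  bound : ∀ i → js i < suc (js Fin.zero) + B
  bound Fin.zero    = m≤m+n (suc (js Fin.zero)) B
  bound (Fin.suc i) = ≤-trans (below i) (m≤n+m B (suc (js Fin.zero)))

finite-does-not-cover : ∀ n (js : Fin n → ℕ) → ¬ (∀ d → Σ[ i ∈ Fin n ] d ≡ js i)
finite-does-not-cover n js covers with finite-bounded n js
... | B , below with covers B
... | i , B≡js = <-irrefl (sym B≡js) (below i)

-- An arrow (t , m) : 0 → J is an agent of kind t placed
-- in the context m.
data Ob : Set where
  obj0 objJ : Ob

data Tag : Set where
  tagA tagB tagZ : Tag

tag-≟ : DecidableEquality Tag
tag-≟ tagA tagA = yes refl
tag-≟ tagB tagB = yes refl
tag-≟ tagZ tagZ = yes refl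
tag-≟ tagA tagB = no λ ()
tag-≟ tagA tagZ = no λ ()
tag-≟ tagB tagA = no λ ()
tag-≟ tagB tagZ = no λ ()
tag-≟ tagZ tagA = no λ ()
tag-≟ tagZ tagB = no λ ()

Arr : Ob → Ob → Set
Arr obj0 obj0 = ⊤
Arr obj0 objJ = Tag × ℕ
Arr objJ obj0 = ⊥
Arr objJ objJ = ℕ

idArr : ∀ {A} → Arr A A
idArr {obj0} = tt
idArr {objJ} = 0

infixr 9 _∘ₐ_
_∘ₐ_ : ∀ {A B C} → Arr A B → Arr B C → Arr A C
_∘ₐ_ {obj0} {obj0} {obj0} _       _ = tt
_∘ₐ_ {obj0} {obj0} {objJ} _       g = g
_∘ₐ_ {obj0} {objJ} {objJ} (t , m) n = t , m + n
_∘ₐ_ {objJ} {objJ} {objJ} m       n = m + n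
_∘ₐ_ {obj0} {objJ} {obj0} _       ()
_∘ₐ_ {objJ} {obj0}        ()      _
_∘ₐ_ {objJ} {objJ} {obj0} _       ()

∘ₐ-identityˡ : ∀ {A B} (f : Arr A B) → idArr ∘ₐ f ≡ f
∘ₐ-identityˡ {obj0} {obj0} _ = refl
∘ₐ-identityˡ {obj0} {objJ} _ = refl
∘ₐ-identityˡ {objJ} {objJ} _ = refl
∘ₐ-identityˡ {objJ} {obj0} ()

∘ₐ-identityʳ : ∀ {A B} (f : Arr A B) → f ∘ₐ idArr ≡ f
∘ₐ-identityʳ {obj0} {obj0} _       = refl
∘ₐ-identityʳ {obj0} {objJ} (t , m) = cong (t ,_) (+-identityʳ m)
∘ₐ-identityʳ {objJ} {objJ} m       = +-identityʳ m
∘ₐ-identityʳ {objJ} {obj0} ()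

∘ₐ-assoc : ∀ {A B C D} (f : Arr A B) (g : Arr B C) (h : Arr C D) →
           (f ∘ₐ g) ∘ₐ h ≡ f ∘ₐ (g ∘ₐ h)
∘ₐ-assoc {obj0} {obj0} {obj0} {obj0} _       _ _ = refl
∘ₐ-assoc {obj0} {obj0} {obj0} {objJ} _       _ _ = refl
∘ₐ-assoc {obj0} {obj0} {objJ} {objJ} _       _ _ = refl
∘ₐ-assoc {obj0} {objJ} {objJ} {objJ} (t , m) g h = cong (t ,_) (+-assoc m g h)
∘ₐ-assoc {objJ} {objJ} {objJ} {objJ} f       g h = +-assoc f g h
∘ₐ-assoc {obj0} {obj0} {objJ} {obj0} _       _ ()
∘ₐ-assoc {obj0} {objJ} {obj0}        _       () _
∘ₐ-assoc {obj0} {objJ} {objJ} {obj0} _       _ ()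
∘ₐ-assoc {objJ} {obj0}               ()      _ _
∘ₐ-assoc {objJ} {objJ} {obj0}        _       () _
∘ₐ-assoc {objJ} {objJ} {objJ} {obj0} _       _ ()

ℕ-category : Category
ℕ-category = record
  { Obj = Ob ; Hom = Arr ; id = idArr ; _⨾_ = _∘ₐ_
  ; identityˡ = ∘ₐ-identityˡ ; identityʳ = ∘ₐ-identityʳ ; assoc = ∘ₐ-assoc }

Square : Ob → Ob → Set
Square B₁ B₂ = Σ[ D ∈ Ob ] (Arr B₁ D × Arr B₂ D)

-- The representative squares: the "join" square of ℕ for spans into J (only
-- between equal tags, since contexts never change a tag), identities
-- otherwise.
joinSquare : ℕ → ℕ → Square objJ objJ
joinSquare h c = objJ , c ∸ h , h ∸ c

κ-ℕ : ∀ {A B₁ B₂} → Arr A B₁ → Arr A B₂ → List (Square B₁ B₂)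
κ-ℕ {obj0} {obj0} {obj0} _       _         = (obj0 , tt , tt) ∷ []
κ-ℕ {obj0} {obj0} {objJ} _       x         = (objJ , x , 0) ∷ []
κ-ℕ {obj0} {objJ} {obj0} x       _         = (objJ , 0 , x) ∷ []
κ-ℕ {obj0} {objJ} {objJ} (t , m) (t' , m') with tag-≟ t t'
... | yes _ = joinSquare m m' ∷ []
... | no  _ = []
κ-ℕ {objJ} {objJ} {objJ} h       c         = joinSquare h c ∷ []
κ-ℕ {objJ} {obj0}        ()      _
κ-ℕ {objJ} {objJ} {obj0} _       ()

κ-ℕ-commutes : ∀ {A B₁ B₂} (α₁ : Arr A B₁) (α₂ : Arr A B₂) {D : Ob}
  {β₁ : Arr B₁ D} {β₂ : Arr B₂ D} → (D , β₁ , β₂) ∈ κ-ℕ α₁ α₂ → α₁ ∘ₐ β₁ ≡ α₂ ∘ₐ β₂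
κ-ℕ-commutes {obj0} {obj0} {obj0} _ _ (here refl) = refl
κ-ℕ-commutes {obj0} {obj0} {objJ} _ x (here refl) = sym (∘ₐ-identityʳ x)
κ-ℕ-commutes {obj0} {objJ} {obj0} x _ (here refl) = ∘ₐ-identityʳ x
κ-ℕ-commutes {obj0} {objJ} {objJ} (t , m) (t' , m') p with tag-≟ t t' | p
... | yes refl | here refl = cong (t ,_) (join-commutes m m')
... | yes _    | there ()
κ-ℕ-commutes {objJ} {objJ} {objJ} h c (here refl) = join-commutes h c
κ-ℕ-commutes {objJ} {obj0}        () _ _
κ-ℕ-commutes {objJ} {objJ} {obj0} _ () _

,-injective : ∀ {t t' : Tag} {m m' : ℕ} → (t , m) ≡ (t' , m') → t ≡ t' × m ≡ m'
,-injective refl = refl , refl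

κ-ℕ-representative : ∀ {A B₁ B₂ E} (α₁ : Arr A B₁) (α₂ : Arr A B₂)
  (δ₁ : Arr B₁ E) (δ₂ : Arr B₂ E) → α₁ ∘ₐ δ₁ ≡ α₂ ∘ₐ δ₂ →
  Σ[ D ∈ Ob ] Σ[ β₁ ∈ Arr B₁ D ] Σ[ β₂ ∈ Arr B₂ D ]
    ((D , β₁ , β₂) ∈ κ-ℕ α₁ α₂ × Σ[ γ ∈ Arr D E ] (δ₁ ≡ β₁ ∘ₐ γ × δ₂ ≡ β₂ ∘ₐ γ))
κ-ℕ-representative {obj0} {obj0} {obj0} {obj0} _ _ _  _  _ =
  obj0 , tt , tt , here refl , tt , refl , refl
κ-ℕ-representative {obj0} {obj0} {obj0} {objJ} _ _ δ₁ _  e =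
  obj0 , tt , tt , here refl , δ₁ , refl , sym e
κ-ℕ-representative {obj0} {obj0} {objJ} {objJ} _ x _  δ₂ e =
  objJ , x , 0 , here refl , δ₂ , e , refl
κ-ℕ-representative {obj0} {objJ} {obj0} {objJ} x _ δ₁ _  e =
  objJ , 0 , x , here refl , δ₁ , refl , sym e
κ-ℕ-representative {obj0} {objJ} {objJ} {objJ} (t , m) (t' , m') δ₁ δ₂ e
  with tag-≟ t t' | ,-injective e
... | yes _ | _ , m+δ₁≡m'+δ₂ =
  let (γ , δ₁≡ , δ₂≡) = join-factors m m' δ₁ δ₂ m+δ₁≡m'+δ₂
  in objJ , m' ∸ m , m ∸ m' , here refl , γ , δ₁≡ , δ₂≡
... | no t≢t' | t≡t' , _ = ⊥-elim (t≢t' t≡t')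
κ-ℕ-representative {objJ} {objJ} {objJ} {objJ} h c δ₁ δ₂ e =
  let (γ , δ₁≡ , δ₂≡) = join-factors h c δ₁ δ₂ e
  in objJ , c ∸ h , h ∸ c , here refl , γ , δ₁≡ , δ₂≡
κ-ℕ-representative {obj0} {obj0} {objJ} {obj0} _ _ _  () _
κ-ℕ-representative {obj0} {objJ} {obj0} {obj0} _ _ () _  _
κ-ℕ-representative {obj0} {objJ} {objJ} {obj0} _ _ () _  _
κ-ℕ-representative {objJ} {obj0}               () _ _ _  _
κ-ℕ-representative {objJ} {objJ} {obj0}        _ () _ _  _
κ-ℕ-representative {objJ} {objJ} {objJ} {obj0} _ _ () _  _

ℕ-setting : Setting
ℕ-setting = record
  { cat = ℕ-category ; 𝟎 = obj0 ; κ = κ-ℕ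
  ; κ-commutes = κ-ℕ-commutes ; κ-representative = κ-ℕ-representative }

module Counterexample where
  open Theory ℕ-setting

  false : Cond objJ
  false = cond ∃Q []

  -- "The context does not factor through 1", i.e. it is the identity 0.
  isIdentity : Cond objJ
  isIdentity = cond ∀Q ((objJ , 1 , false) ∷ [])

  contextIs : ℕ → Cond objJ
  contextIs j = cond ∃Q ((objJ , j , isIdentity) ∷ [])

  ⊨isIdentity↓ : ∀ α (g : ℕ) → g ⊨ (isIdentity ↓ α) → α ≡ 0 × g ≡ 0
  ⊨isIdentity↓ zero    zero    _             = refl , refl
  ⊨isIdentity↓ zero    (suc g) (noFactor , _) = ⊥-elim (noFactor g refl)
  ⊨isIdentity↓ (suc α) g       (noFactor , _) =
    ⊥-elim (noFactor g (cong (_+ g) (sym (0∸n≡0 α))))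

  0⊨isIdentity↓0 : (0 ⊨ (isIdentity ↓ 0))
  0⊨isIdentity↓0 = (λ _ ()) , tt

  ⊨contextIs↓-sound : ∀ j n (d : ℕ) → d ⊨ (contextIs j ↓ n) → n + d ≡ j
  ⊨contextIs↓-sound j n d (inj₁ (g , d≡ , g⊨)) with ⊨isIdentity↓ (n ∸ j) g g⊨
  ... | n∸j≡0 , refl = begin
    n + d           ≡⟨ cong (n +_) d≡ ⟩
    n + (j ∸ n + 0) ≡⟨ cong (n +_) (+-identityʳ (j ∸ n)) ⟩
    n + (j ∸ n)     ≡⟨ m+[n∸m]≡n (m∸n≡0⇒m≤n n∸j≡0) ⟩
    j               ∎
    where open ≡-Reasoning

  ⊨contextIs↓-complete : ∀ n (d : ℕ) → d ⊨ (contextIs (n + d) ↓ n)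
  ⊨contextIs↓-complete n d = inj₁ (0 , d≡ , subst (λ α → 0 ⊨ (isIdentity ↓ α))
                                                   (sym (m≤n⇒m∸n≡0 (m≤m+n n d)))
                                                   0⊨isIdentity↓0)
    where
    d≡ : d ≡ (n + d ∸ n) + 0
    d≡ = sym (trans (+-identityʳ _) (m+n∸m≡n n d))

  rules : ⊤ ⊎ ℕ → Rule
  rules (inj₁ _) = record { I = objJ ; ℓ = tagA , 0 ; r = tagZ , 0 ; R = true objJ }
  rules (inj₂ j) = record { I = objJ ; ℓ = tagB , 0 ; r = tagZ , 0 ; R = contextIs j }

  system : System
  system = record { Idx = ⊤ ⊎ ℕ ; rule = rules }

  agentA agentB : Arr obj0 objJ
  agentA = tagA , 0
  agentB = tagB , 0

  data Related : ∀ {J} → Arr obj0 J → Arr obj0 J → Cond J → Set where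
    A~B : ∀ {𝒞} → Related agentA agentB 𝒞
    B~A : ∀ {𝒞} → Related agentB agentA 𝒞
    Z~Z : ∀ {m m' 𝒞} → Related (tagZ , m) (tagZ , m') 𝒞

  Related-sym : ∀ {J} {x y : Arr obj0 J} {𝒞} → Related x y 𝒞 → Related y x 𝒞
  Related-sym A~B = B~A
  Related-sym B~A = A~B
  Related-sym Z~Z = Z~Z

  -- A's step under context n is answered by B's steps under every rule
  -- contextIs j, covering all total contexts; each B-step is answered by A's
  -- unconditional step; Z-agents do not reduce.
  Related-condSim : CondSim system Related
  Related-condSim {K = obj0} _ _ _ A~B () _ _ _
  Related-condSim {K = obj0} _ _ _ B~A () _ _ _
  Related-condSim {K = obj0} _ _ _ Z~Z () _ _ _
  Related-condSim {K = objJ} _ _ 𝒞 A~B n 𝒜 _ (inj₁ _ , _ , refl , refl , _) =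
    ℕ , (λ j → contextIs j ↓ n) , (λ _ → tagZ , n) , (λ _ → true objJ) ,
    (λ j → inj₂ j , n , refl , refl , λ _ d⊨ → d⊨) , (λ _ → Z~Z) , covers
    where
    covers : ∀ {L} (d : Arr objJ L) → d ⊨ 𝒜 → d ⊨ (𝒞 ↓ n) →
             Σ[ j ∈ ℕ ] (d ⊨ true objJ × d ⊨ (contextIs j ↓ n))
    covers {obj0} ()
    covers {objJ} d _ _ = n + d , tt , ⊨contextIs↓-complete n d
  Related-condSim {K = objJ} _ _ _ A~B _ _ _ (inj₂ _ , _ , () , _)
  Related-condSim {K = objJ} _ _ _ B~A n 𝒜 _ (inj₂ _ , _ , refl , refl , _) =
    ⊤ , (λ _ → 𝒜) , (λ _ → tagZ , n) , (λ _ → true objJ) ,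
    (λ _ → inj₁ tt , n , refl , refl , λ _ _ → tt) , (λ _ → Z~Z) ,
    λ _ d⊨𝒜 _ → tt , tt , d⊨𝒜
  Related-condSim {K = objJ} _ _ _ B~A _ _ _ (inj₁ _ , _ , () , _)
  Related-condSim {K = objJ} _ _ _ Z~Z _ _ _ (inj₁ _ , _ , () , _)
  Related-condSim {K = objJ} _ _ _ Z~Z _ _ _ (inj₂ _ , _ , () , _)

  A≃TB : _≃T_ system agentA agentB
  A≃TB = Related ,
         General.symmetric-condBisim ℕ-setting system Related-sym Related-condSim ,
         A~B

  B-step-pins-context : ∀ {ℬ b'} → Step system agentB 0 ℬ b' →
    Σ[ j ∈ ℕ ] (∀ (d : ℕ) → d ⊨ ℬ → d ≡ j)
  B-step-pins-context (inj₁ _ , _ , () , _)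
  B-step-pins-context (inj₂ j , _ , refl , _ , ℬ⊨R) =
    j , λ d d⊨ℬ → ⊨contextIs↓-sound j 0 d (ℬ⊨R d d⊨ℬ)

  -- A's unconditional step in the empty context would need finitely many
  -- B-steps covering every context d, each of which pins d: impossible.
  A≁CB : ¬ (_∼C_ system agentA agentB)
  A≁CB (Rel , (forth , _) , aRb)
    with forth agentA agentB aRb 0 (true objJ) (tagZ , 0) (inj₁ tt , 0 , refl , refl , λ _ _ → tt)
  ... | n , ℬ , _ , steps , _ , covers =
    finite-does-not-cover n (proj₁ ∘ pin) λ d →
      let (i , d⊨ℬi) = covers d tt in i , proj₂ (pin i) d d⊨ℬi
    where
    pin : ∀ i → Σ[ j ∈ ℕ ] (∀ (d : ℕ) → d ⊨ ℬ i → d ≡ j)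
    pin i = B-step-pins-context {ℬ i} (steps i)

theorem6p5 : ((X : Setting) → let open Theory X in
    (𝒮 : System) → ∀ {J} (a b : Hom 𝟎 J) → _∼C_ 𝒮 a b → _≃T_ 𝒮 a b)
    ×
    (Σ[ X ∈ Setting ] (let open Theory X in
    Σ[ 𝒮 ∈ System ] Σ[ J ∈ Obj ] Σ[ a ∈ Hom 𝟎 J ] Σ[ b ∈ Hom 𝟎 J ]
    (_≃T_ 𝒮 a b × ¬ (_∼C_ 𝒮 a b))))
theorem6p5 =
  General.∼C⇒≃T ,
  ℕ-setting , system , objJ , agentA , agentB , A≃TB , A≁CB
  where open Counterexample
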